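{- Let $f:A\to B$ be a homomorphism of finite MTL-chains. If $A$ is archimedean, then $B$ is the trivial one-element MTL-chain or $f$ is injective.
   Context: An MTL-algebra is a bounded, integral, commutative residuated lattice satisfying $(x\to y)\vee(y\to x)=1$; an MTL-chain is a totally ordered one. An MTL-chain is archimedean if for all $x\le y<1$ there is $n$ with $y^n\le x$. -}

module Defs where

open import Level using (0ℓ)
open import Data.Nat using (ℕ; zero; suc)
open import Data.Fin using (Fin)
open import Data.Product using (Σ; ∃; _×_)
open import Function.Bundles using (_↔_)
open import Relation.Binary.PropositionalEquality using (_≡_)
open import Relation.Binary.Structures using (IsTotalOrder)
open import Relation.Nullary using (¬_)

-- An MTL-chain: a bounded, integral, commutative residuated lattice whose
-- lattice order is total.  (Prelinearity (x→y)∨(y→x)=1 holds automatically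
-- in a chain, but we include it anyway, as in the definition.)
-- Equality on the carrier is propositional equality.
record MTLChain : Set₁ where
  infixl 7 _·_
  infixr 5 _⇒_
  infixl 6 _∧_ _∨_
  field
    Carrier : Set
    _≤_     : Carrier → Carrier → Set
    _∧_ _∨_ _·_ _⇒_ : Carrier → Carrier → Carrier
    𝟘 𝟙     : Carrier
    isTotalOrder : IsTotalOrder _≡_ _≤_
    ∧-lb₁ : ∀ x y → (x ∧ y) ≤ x
    ∧-lb₂ : ∀ x y → (x ∧ y) ≤ y
    ∧-glb : ∀ x y z → z ≤ x → z ≤ y → z ≤ (x ∧ y)
    ∨-ub₁ : ∀ x y → x ≤ (x ∨ y)
    ∨-ub₂ : ∀ x y → y ≤ (x ∨ y)
    ∨-lub : ∀ x y z → x ≤ z → y ≤ z → (x ∨ y) ≤ z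
    𝟘-min : ∀ x → 𝟘 ≤ x
    𝟙-max : ∀ x → x ≤ 𝟙
    ·-assoc : ∀ x y z → (x · y) · z ≡ x · (y · z)
    ·-comm  : ∀ x y → x · y ≡ y · x
    ·-idʳ   : ∀ x → x · 𝟙 ≡ x
    res⇒ : ∀ x y z → (x · y) ≤ z → x ≤ (y ⇒ z)
    res⇐ : ∀ x y z → x ≤ (y ⇒ z) → (x · y) ≤ z
    prelin : ∀ x y → ((x ⇒ y) ∨ (y ⇒ x)) ≡ 𝟙

  _^_ : Carrier → ℕ → Carrier
  y ^ zero  = 𝟙
  y ^ suc n = y · (y ^ n)

open MTLChain public

Finite : MTLChain → Set
Finite A = Σ ℕ λ n → Carrier A ↔ Fin n

Archimedean : MTLChain → Set
Archimedean A = ∀ x y → _≤_ A x y → ¬ (y ≡ 𝟙 A) →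
  ∃ λ n → _≤_ A (_^_ A y n) x

Trivial : MTLChain → Set
Trivial B = ∀ (x y : Carrier B) → x ≡ y

record Hom (A B : MTLChain) : Set where
  field
    fun   : Carrier A → Carrier B
    pres-· : ∀ x y → fun (_·_ A x y) ≡ _·_ B (fun x) (fun y)
    pres-⇒ : ∀ x y → fun (_⇒_ A x y) ≡ _⇒_ B (fun x) (fun y)
    pres-∧ : ∀ x y → fun (_∧_ A x y) ≡ _∧_ B (fun x) (fun y)
    pres-∨ : ∀ x y → fun (_∨_ A x y) ≡ _∨_ B (fun x) (fun y)
    pres-𝟘 : fun (𝟘 A) ≡ 𝟘 B
    pres-𝟙 : fun (𝟙 A) ≡ 𝟙 B

open Hom public

module Submission where

-- In an archimedean chain every element c ≠ 1 is nilpotent: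
-- the archimedean property applied to 0 ≤ c gives cⁿ = 0.  Hence if f sends
-- some c ≠ 1 to 1, then 1 = 1ⁿ = f(c)ⁿ = f(cⁿ) = f(0) = 0 in B, so B collapses.
-- Now suppose f identifies two distinct elements a, b; by totality a < b, say.
-- The residuum c = b → a is then ≠ 1 (otherwise b ≤ a), yet
-- f(c) = f(b) → f(a) = f(a) → f(a) = 1, so B collapses.
--
-- Finiteness is used only to make equality
-- decidable, which turns "B collapses or f is injective" into a disjunction.

open import Defs using (MTLChain; Finite; Archimedean; Trivial; Hom; fun)
open import Data.Nat using (zero; suc)
open import Data.Product using (∃; _,_)
open import Data.Sum using (_⊎_; inj₁; inj₂)
open import Data.Empty using (⊥-elim)
import Data.Fin.Properties as Fin
open import Function.Bundles using (Inverse)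
open import Function.Definitions using (Injective)
open import Relation.Binary.Definitions using (DecidableEquality)
open import Relation.Binary.Structures using (IsTotalOrder)
open import Relation.Nullary using (yes; no)
open import Relation.Nullary.Decidable using (map′)
open import Relation.Binary.PropositionalEquality
  using (_≡_; _≢_; ≢-sym; refl; sym; trans; cong; subst; module ≡-Reasoning)

module ChainFacts (A : MTLChain) where
  open MTLChain A
  open IsTotalOrder isTotalOrder using (reflexive; antisym)

  ≤-refl : ∀ {x} → x ≤ x
  ≤-refl = reflexive refl

  ·-idˡ : ∀ x → 𝟙 · x ≡ x
  ·-idˡ x = trans (·-comm 𝟙 x) (·-idʳ x)

  ⇒-refl : ∀ x → x ⇒ x ≡ 𝟙
  ⇒-refl x = antisym (𝟙-max _) (res⇒ 𝟙 x x (subst (_≤ x) (sym (·-idˡ x)) ≤-refl))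

  ⇒≡𝟙⇒≤ : ∀ {x y} → x ⇒ y ≡ 𝟙 → x ≤ y
  ⇒≡𝟙⇒≤ {x} {y} x⇒y≡𝟙 =
    subst (_≤ y) (·-idˡ x) (res⇐ 𝟙 x y (subst (𝟙 ≤_) (sym x⇒y≡𝟙) ≤-refl))

  <⇒residuum≢𝟙 : ∀ {a b} → a ≤ b → a ≢ b → b ⇒ a ≢ 𝟙
  <⇒residuum≢𝟙 a≤b a≢b b⇒a≡𝟙 = a≢b (antisym a≤b (⇒≡𝟙⇒≤ b⇒a≡𝟙))

  𝟙^ : ∀ n → 𝟙 ^ n ≡ 𝟙
  𝟙^ zero    = refl
  𝟙^ (suc n) = trans (cong (𝟙 ·_) (𝟙^ n)) (·-idʳ 𝟙)

  degenerate⇒trivial : 𝟙 ≡ 𝟘 → Trivial A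
  degenerate⇒trivial 𝟙≡𝟘 x y = trans (collapse x) (sym (collapse y))
    where
    collapse : ∀ z → z ≡ 𝟘
    collapse z = antisym (subst (z ≤_) 𝟙≡𝟘 (𝟙-max z)) (𝟘-min z)

  archimedean⇒nilpotent : Archimedean A → ∀ c → c ≢ 𝟙 → ∃ λ n → c ^ n ≡ 𝟘
  archimedean⇒nilpotent arch c c≢𝟙 with arch 𝟘 c (𝟘-min c) c≢𝟙
  ... | n , cⁿ≤𝟘 = n , antisym cⁿ≤𝟘 (𝟘-min _)

  finite⇒≟ : Finite A → DecidableEquality Carrier
  finite⇒≟ (_ , iso) x y =
    map′ (λ e → trans (sym (from∘to x)) (trans (cong from e) (from∘to y)))
         (cong to)
         (to x Fin.≟ to y)
    where
    open Inverse iso using (to; from) renaming (strictlyInverseʳ to from∘to)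

module ArchimedeanHom (A B : MTLChain) (f : Hom A B) (arch : Archimedean A) where
  private
    module S = MTLChain A
    module T = MTLChain B
    module SF = ChainFacts A
    module TF = ChainFacts B
  open Hom f using (pres-·; pres-⇒; pres-𝟘; pres-𝟙)

  pres-^ : ∀ c n → fun f (c S.^ n) ≡ fun f c T.^ n
  pres-^ c zero    = pres-𝟙
  pres-^ c (suc n) = trans (pres-· c (c S.^ n)) (cong (fun f c T.·_) (pres-^ c n))

  nontrivial-kernel⇒degenerate : ∀ c → c ≢ S.𝟙 → fun f c ≡ T.𝟙 → T.𝟙 ≡ T.𝟘
  nontrivial-kernel⇒degenerate c c≢𝟙 fc≡𝟙 with SF.archimedean⇒nilpotent arch c c≢𝟙
  ... | n , cⁿ≡𝟘 = begin
    T.𝟙               ≡⟨ sym (TF.𝟙^ n) ⟩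
    T.𝟙 T.^ n         ≡⟨ cong (T._^ n) (sym fc≡𝟙) ⟩
    fun f c T.^ n     ≡⟨ sym (pres-^ c n) ⟩
    fun f (c S.^ n)   ≡⟨ cong (fun f) cⁿ≡𝟘 ⟩
    fun f S.𝟘         ≡⟨ pres-𝟘 ⟩
    T.𝟘               ∎
    where open ≡-Reasoning

  identified<⇒degenerate : ∀ {a b} → a S.≤ b → a ≢ b → fun f a ≡ fun f b → T.𝟙 ≡ T.𝟘
  identified<⇒degenerate {a} {b} a≤b a≢b fa≡fb =
    nontrivial-kernel⇒degenerate (b S.⇒ a) (SF.<⇒residuum≢𝟙 a≤b a≢b) f[b⇒a]≡𝟙
    where
    open ≡-Reasoning
    f[b⇒a]≡𝟙 : fun f (b S.⇒ a) ≡ T.𝟙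
    f[b⇒a]≡𝟙 = begin
      fun f (b S.⇒ a)         ≡⟨ pres-⇒ b a ⟩
      fun f b T.⇒ fun f a     ≡⟨ cong (fun f b T.⇒_) fa≡fb ⟩
      fun f b T.⇒ fun f b     ≡⟨ TF.⇒-refl (fun f b) ⟩
      T.𝟙                     ∎

  injective-unless-degenerate : DecidableEquality S.Carrier → T.𝟙 ≢ T.𝟘 →
    Injective _≡_ _≡_ (fun f)
  injective-unless-degenerate _≟_ 𝟙≢𝟘 {a} {b} fa≡fb with a ≟ b
  ... | yes a≡b = a≡b
  ... | no a≢b with IsTotalOrder.total S.isTotalOrder a b
  ...   | inj₁ a≤b = ⊥-elim (𝟙≢𝟘 (identified<⇒degenerate a≤b a≢b fa≡fb))
  ...   | inj₂ b≤a = ⊥-elim (𝟙≢𝟘 (identified<⇒degenerate b≤a (≢-sym a≢b) (sym fa≡fb)))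

lemma2p6 : (A B : MTLChain) → Finite A → Finite B → (f : Hom A B) →
    Archimedean A → Trivial B ⊎ Injective _≡_ _≡_ (fun f)
lemma2p6 A B finA finB f arch
  with ChainFacts.finite⇒≟ B finB (MTLChain.𝟙 B) (MTLChain.𝟘 B)
... | yes 𝟙≡𝟘 = inj₁ (ChainFacts.degenerate⇒trivial B 𝟙≡𝟘)
... | no 𝟙≢𝟘  = inj₂ (ArchimedeanHom.injective-unless-degenerate A B f arch
                        (ChainFacts.finite⇒≟ A finA) 𝟙≢𝟘)
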